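{- Let $b\geq 2$ be an integer. For each even $n\geq 2$, each sequence $(a_1,\dots,a_n)$ of positive integers and each integer $k\geq 0$, there is at most one integer $c\in \{b^k,b^k+1,\dots,b^{k+1}-1\}$ such that the interval $I(a_1,\dots,a_n,c)$ intersects $T_b$.
   Context: For a finite sequence $(a_1,\dots,a_m)$ of positive integers, $I(a_1,\dots,a_m)$ denotes the open interval whose endpoints are the continued fractions $[0;a_1,\dots,a_{m-1},a_m]$ and $[0;a_1,\dots,a_{m-1},a_m+1]$. A real number $x$ is a Trott number in base $b$ if $x\in(0,1)$ has an infinite continued fraction expansion $x=[0;a_1,a_2,\dots]$ with all $a_i$ positive integers and the base-$b$ expansion of $x$ is $(0.\hat{a}_1\hat{a}_2\hat{a}_3\dots)_b$, where $\hat{a}_i$ is the string of base-$b$ digits of $a_i$ (without leading zeros), concatenated. $T_b$ is the set of Trott numbers in base $b$. -}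

module Defs where

open import Data.Nat as ℕ using (ℕ; zero; suc; _+_; _*_; _∸_; _^_; _≤?_)
open import Data.Integer using (+_)
open import Data.Rational.Unnormalised as Q
  using (ℚᵘ; mkℚᵘ; _<_; ∣_∣; _-_; 0ℚᵘ; 1ℚᵘ)
open import Data.List using (List; []; _∷_; _∷ʳ_; applyUpTo)
open import Data.Product using (_×_; _,_; ∃; ∃-syntax)
open import Data.Sum using (_⊎_)
open import Relation.Nullary using (yes; no)

-- The rational p / q.  Only ever used with q ≥ 1 (continued-fraction
-- denominators with positive partial quotients, and powers b ^ L with b ≥ 2).
frac : ℕ → ℕ → ℚᵘ
frac p q = mkℚᵘ (+ p) (q ∸ 1)

-- (numerator, denominator) of [0; a₁, …, aₘ], computed from the right:
-- [0;] = 0/1 and [0; a, rest] = 1 / (a + [0; rest]) = q / (a q + p).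
cfPair : List ℕ → ℕ × ℕ
cfPair [] = 0 , 1
cfPair (a ∷ as) with cfPair as
... | p , q = q , a * q + p

cf : List ℕ → ℚᵘ
cf as with cfPair as
... | p , q = frac p q

-- The first m terms (a₁, …, aₘ) of an infinite sequence a, where a 0 = a₁.
prefix : (ℕ → ℕ) → ℕ → List ℕ
prefix a m = applyUpTo a m

-- Sequence of convergents [0; a₁, …, aₘ]; its limit is [0; a₁, a₂, …].
cfSeq : (ℕ → ℕ) → ℕ → ℚᵘ
cfSeq a m = cf (prefix a m)

-- Real numbers represented as (Cauchy) sequences of rationals:
-- equality and strict order of the limits.

const : ℚᵘ → ℕ → ℚᵘ
const r _ = r

_≈ℝ_ : (ℕ → ℚᵘ) → (ℕ → ℚᵘ) → Set
s ≈ℝ t = ∀ (ε : ℚᵘ) → 0ℚᵘ < ε → ∃[ M ] (∀ m → M ℕ.≤ m → ∣ s m - t m ∣ < ε)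

_<ℝ_ : (ℕ → ℚᵘ) → (ℕ → ℚᵘ) → Set
s <ℝ t = ∃[ δ ] (0ℚᵘ < δ × ∃[ M ] (∀ m → M ℕ.≤ m → s m Q.+ δ < t m))

InOpenInterval : ℚᵘ → ℚᵘ → (ℕ → ℚᵘ) → Set
InOpenInterval u v s =
  (const u <ℝ s × s <ℝ const v) ⊎ (const v <ℝ s × s <ℝ const u)

-- Number of base-b digits of a ≥ 1: the least L with a < b ^ L.
-- (Search L = 0, 1, … ; fuel suc a suffices since a < b ^ (suc a) for b ≥ 2.)
numDigitsAux : ℕ → ℕ → ℕ → ℕ → ℕ
numDigitsAux b a zero L = L
numDigitsAux b a (suc f) L with b ^ L ≤? a
... | yes _ = numDigitsAux b a f (suc L)
... | no _  = L

numDigits : ℕ → ℕ → ℕ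
numDigits b a = numDigitsAux b a (suc a) 0

-- Concatenating the base-b digit strings of a₁, …, aₘ gives the natural
-- number concatNum b a m, which has concatLen b a m digits.
concatLen : ℕ → (ℕ → ℕ) → ℕ → ℕ
concatLen b a zero = 0
concatLen b a (suc m) = concatLen b a m + numDigits b (a m)

concatNum : ℕ → (ℕ → ℕ) → ℕ → ℕ
concatNum b a zero = 0
concatNum b a (suc m) = concatNum b a m * b ^ numDigits b (a m) + a m

-- (0.â₁â₂…âₘ)_b ; its limit is the base-b value (0.â₁â₂â₃…)_b.
digitSeq : ℕ → (ℕ → ℕ) → ℕ → ℚᵘ
digitSeq b a m = frac (concatNum b a m) (b ^ concatLen b a m)

-- The real x = [0; a₁, a₂, …] (a sequence of positive integers) is a Trott
-- number in base b: x ∈ (0,1) and its base-b expansion is (0.â₁â₂â₃…)_b.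
IsTrottCF : ℕ → (ℕ → ℕ) → Set
IsTrottCF b a =
  (∀ i → 1 ℕ.≤ a i)
  × (const 0ℚᵘ <ℝ cfSeq a × cfSeq a <ℝ const 1ℚᵘ)
  × (cfSeq a ≈ℝ digitSeq b a)

IntersectsTrott : ℕ → List ℕ → ℕ → Set
IntersectsTrott b pre c =
  ∃[ a ] (IsTrottCF b a × InOpenInterval (cf (pre ∷ʳ c)) (cf (pre ∷ʳ suc c)) (cfSeq a))

{-# OPTIONS --safe #-}
module Submission where

-- For even n the map c ↦ [0; a₁,…,aₙ,c] is decreasing, so if c < c′ the whole
-- interval I(a₁,…,aₙ,c′) lies below I(a₁,…,aₙ,c).  These intervals are
-- cylinder sets: a continued fraction [0; x₁, x₂, …] lying in I(a₁,…,aₙ,c)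
-- starts with a₁,…,aₙ,c.  So a Trott number in I(…,c) has base-b expansion
-- starting with â₁…âₙĉ, and one in I(…,c′) starts with â₁…âₙĉ′.  When c and c′
-- have the same number of digits, c < c′ makes the first expansion the smaller
-- one, contradicting the order of the intervals.  Reals being Cauchy sequences
-- of rationals, the argument is run on one late enough convergent and
-- truncated expansion.

open import Defs
open import Data.Nat
open import Data.Nat.Properties
import Data.Nat.Solver as ℕ-Solver
open import Data.Nat.Divisibility using (_∣_; divides)
import Data.Integer as ℤ
import Data.Integer.Properties as ℤ
open import Data.Rational.Unnormalised using (mkℚᵘ; *≤*; *<*)
import Data.Rational.Unnormalised as ℚ
import Data.Rational.Unnormalised.Properties as ℚ
import Data.Rational.Unnormalised.Solver as ℚ-Solver
open import Data.List using (List; []; _∷_; _∷ʳ_; length)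
open import Data.List.Properties using (applyUpTo-∷ʳ; ∷ʳ-injective)
import Data.List.Relation.Unary.All as List
open import Data.List.Relation.Unary.All.Properties using (∷ʳ⁺; applyUpTo⁺₂)
open import Data.Vec using (Vec; toList)
open import Data.Vec.Properties using (length-toList)
open import Data.Vec.Relation.Unary.All using (All)
open import Data.Vec.Relation.Unary.All.Properties using (toList⁺)
open import Data.Product using (_×_; _,_; proj₂; ∃-syntax)
open import Data.Sum using (_⊎_; inj₁; inj₂)
open import Data.Empty using (⊥; ⊥-elim)
open import Function using (_∘_)
open import Relation.Nullary using (yes; no)
open import Relation.Binary.PropositionalEquality

Eventually : (ℕ → Set) → Set
Eventually P = ∃[ M ] (∀ m → M ≤ m → P m)

eventually-zip : ∀ {P Q R : ℕ → Set} → (∀ {m} → P m → Q m → R m) →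
                 Eventually P → Eventually Q → Eventually R
eventually-zip f (M , p) (M′ , q) = M ⊔ M′ , λ m M⊔M′≤m →
  f (p m (≤-trans (m≤m⊔n M M′) M⊔M′≤m)) (q m (≤-trans (m≤n⊔m M M′) M⊔M′≤m))

eventually-beyond : ∀ {P : ℕ → Set} → Eventually P → ∀ k → ∃[ j ] P (j + k)
eventually-beyond (M , p) k = M , p (M + k) (m≤m+n M k)

Between : {A : Set} → (A → A → Set) → A → A → A → Set
Between _≺_ u x v = (u ≺ x × x ≺ v) ⊎ (v ≺ x × x ≺ u)

p≤∣p∣ : ∀ p → p ℚ.≤ ℚ.∣ p ∣
p≤∣p∣ (mkℚᵘ (ℤ.+ n) d)     = ℚ.≤-refl
p≤∣p∣ p@(mkℚᵘ ℤ.-[1+ n ] d) = ℚ.≤-trans (ℚ.<⇒≤ (ℚ.negative⁻¹ p)) (ℚ.0≤∣p∣ p)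

∣p-q∣≡∣q-p∣ : ∀ p q → ℚ.∣ p ℚ.- q ∣ ≡ ℚ.∣ q ℚ.- p ∣
∣p-q∣≡∣q-p∣ p q = begin
  ℚ.∣ p ℚ.- q ∣              ≡⟨ ℚ.∣-p∣≡∣p∣ (p ℚ.- q) ⟨
  ℚ.∣ ℚ.- (p ℚ.- q) ∣        ≡⟨ cong ℚ.∣_∣ (ℚ.neg-distrib-+ p (ℚ.- q)) ⟩
  ℚ.∣ ℚ.- p ℚ.+ ℚ.- ℚ.- q ∣  ≡⟨ cong (λ r → ℚ.∣ ℚ.- p ℚ.+ r ∣) (ℚ.neg-involutive-≡ q) ⟩
  ℚ.∣ ℚ.- p ℚ.+ q ∣          ≡⟨ cong ℚ.∣_∣ (ℚ.+-comm-≡ (ℚ.- p) q) ⟩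
  ℚ.∣ q ℚ.- p ∣              ∎
  where open ≡-Reasoning

∣p-q∣<r⇒p<q+r : ∀ {p q r} → ℚ.∣ p ℚ.- q ∣ ℚ.< r → p ℚ.< q ℚ.+ r
∣p-q∣<r⇒p<q+r {p} {q} {r} ∣p-q∣<r =
  ℚ.<-respʳ-≃ (ℚ.+-comm r q)
    (ℚ.<-respˡ-≃ p-q+q≃p (ℚ.+-monoˡ-< q (ℚ.≤-<-trans (p≤∣p∣ (p ℚ.- q)) ∣p-q∣<r)))
  where
  open ℚ-Solver.+-*-Solver
  p-q+q≃p : (p ℚ.- q) ℚ.+ q ℚ.≃ p
  p-q+q≃p = solve 2 (λ p q → (p :- q) :+ q := p) ℚ.≃-refl p q

∣p-q∣<r⇒q<p+r : ∀ {p q r} → ℚ.∣ p ℚ.- q ∣ ℚ.< r → q ℚ.< p ℚ.+ r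
∣p-q∣<r⇒q<p+r {p} {q} = ∣p-q∣<r⇒p<q+r ∘ subst (ℚ._< _) (∣p-q∣≡∣q-p∣ p q)

p+r<q+r⇒p<q : ∀ {p q r} → p ℚ.+ r ℚ.< q ℚ.+ r → p ℚ.< q
p+r<q+r⇒p<q {p} {q} {r} p+r<q+r =
  ℚ.<-respʳ-≃ (p+r-r≃p q) (ℚ.<-respˡ-≃ (p+r-r≃p p) (ℚ.+-monoˡ-< (ℚ.- r) p+r<q+r))
  where
  open ℚ-Solver.+-*-Solver
  p+r-r≃p : ∀ p → (p ℚ.+ r) ℚ.- r ℚ.≃ p
  p+r-r≃p p = solve 2 (λ p r → (p :+ r) :- r := p) ℚ.≃-refl p r

p<p+q : ∀ {p q} → ℚ.0ℚᵘ ℚ.< q → p ℚ.< p ℚ.+ q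
p<p+q {p} 0<q = ℚ.<-respˡ-≃ (ℚ.+-identityʳ p) (ℚ.+-monoʳ-< p 0<q)

below-limit : ∀ {u s t} → const u <ℝ s → s ≈ℝ t →
              Eventually (λ m → u ℚ.< s m × u ℚ.< t m)
below-limit {u} (δ , δ>0 , M , u+δ<s) s≈t =
  eventually-zip
    (λ u+δ<sm ∣sm-tm∣<δ →
        ℚ.<-trans (p<p+q {u} δ>0) u+δ<sm
      , p+r<q+r⇒p<q (ℚ.<-trans u+δ<sm (∣p-q∣<r⇒p<q+r ∣sm-tm∣<δ)))
    (M , u+δ<s) (s≈t δ δ>0)

above-limit : ∀ {v s t} → s <ℝ const v → s ≈ℝ t →
              Eventually (λ m → s m ℚ.< v × t m ℚ.< v)
above-limit {s = s} (δ , δ>0 , M , s+δ<v) s≈t =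
  eventually-zip
    (λ {m} sm+δ<v ∣sm-tm∣<δ →
        ℚ.<-trans (p<p+q {s m} δ>0) sm+δ<v
      , ℚ.<-trans (∣p-q∣<r⇒q<p+r {s m} ∣sm-tm∣<δ) sm+δ<v)
    (M , s+δ<v) (s≈t δ δ>0)

eventually-between : ∀ {u v s t} → InOpenInterval u v s → s ≈ℝ t →
  Eventually (λ m → Between ℚ._<_ u (s m) v × Between ℚ._<_ u (t m) v)
eventually-between (inj₁ (u<s , s<v)) s≈t =
  eventually-zip (λ (u<sm , u<tm) (sm<v , tm<v) → inj₁ (u<sm , sm<v) , inj₁ (u<tm , tm<v))
    (below-limit u<s s≈t) (above-limit s<v s≈t)
eventually-between (inj₂ (v<s , s<u)) s≈t =
  eventually-zip (λ (v<sm , v<tm) (sm<u , tm<u) → inj₂ (v<sm , sm<u) , inj₂ (v<tm , tm<u))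
    (below-limit v<s s≈t) (above-limit s<u s≈t)

Between-oriented : ∀ {u x v} → v ℚ.≤ u → Between ℚ._<_ u x v → v ℚ.< x × x ℚ.< u
Between-oriented v≤u (inj₁ (u<x , x<v)) = ℚ.≤-<-trans v≤u u<x , ℚ.<-≤-trans x<v v≤u
Between-oriented _   (inj₂ v<x<u)       = v<x<u

frac-mono-≤ : ∀ p {q} p′ {q′} → 0 < q → 0 < q′ → p * q′ ≤ p′ * q → frac p q ℚ.≤ frac p′ q′
frac-mono-≤ p {suc q} p′ {suc q′} _ _ h =
  *≤* (subst₂ ℤ._≤_ (ℤ.pos-* p (suc q′)) (ℤ.pos-* p′ (suc q)) (ℤ.+≤+ h))

frac-cancel-< : ∀ p {q} p′ {q′} → 0 < q → 0 < q′ → frac p q ℚ.< frac p′ q′ → p * q′ < p′ * q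
frac-cancel-< p {suc q} p′ {suc q′} _ _ (*<* h) =
  ℤ.drop‿+<+ (subst₂ ℤ._<_ (sym (ℤ.pos-* p (suc q′))) (sym (ℤ.pos-* p′ (suc q))) h)

_<ᶠ_ : ℕ × ℕ → ℕ × ℕ → Set
(p , q) <ᶠ (p′ , q′) = p * q′ < p′ * q

_≤ᶠ_ : ℕ × ℕ → ℕ × ℕ → Set
(p , q) ≤ᶠ (p′ , q′) = p * q′ ≤ p′ * q

Proper : ℕ × ℕ → Set
Proper (p , q) = p ≤ q

cons : ℕ → ℕ × ℕ → ℕ × ℕ
cons a (p , q) = q , a * q + p

-- 1 / (d + P/Q) < 1 / (a + p/q) gives a ≤ a + p/q < d + P/Q ≤ d + 1.
cons-<ᶠ⇒≤ : ∀ a d ((p , q) (P , Q) : ℕ × ℕ) → P ≤ Q → cons d (P , Q) <ᶠ cons a (p , q) → a ≤ d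
cons-<ᶠ⇒≤ a d (p , q) (P , Q) P≤Q h = ≮⇒≥ λ d<a → <⇒≱ h (begin
  q * (d * Q + P)  ≤⟨ *-monoʳ-≤ q (+-monoʳ-≤ (d * Q) P≤Q) ⟩
  q * (d * Q + Q)  ≡⟨ solve 3 (λ q d Q → q :* (d :* Q :+ Q) := (con 1 :+ d) :* (q :* Q))
                            refl q d Q ⟩
  suc d * (q * Q)  ≤⟨ *-monoˡ-≤ (q * Q) d<a ⟩
  a * (q * Q)      ≡⟨ solve 3 (λ a q Q → a :* (q :* Q) := Q :* (a :* q)) refl a q Q ⟩
  Q * (a * q)      ≤⟨ *-monoʳ-≤ Q (m≤m+n (a * q) p) ⟩
  Q * (a * q + p)  ∎)
  where
  open ≤-Reasoning
  open ℕ-Solver.+-*-Solver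

cons-cancel-<ᶠ : ∀ d ((p , q) (P , Q) : ℕ × ℕ) →
                 cons d (P , Q) <ᶠ cons d (p , q) → (p , q) <ᶠ (P , Q)
cons-cancel-<ᶠ d (p , q) (P , Q) h = +-cancelˡ-< (d * q * Q) _ _ (subst₂ _<_
  (solve 5 (λ d p q P Q → Q :* (d :* q :+ p) := d :* q :* Q :+ p :* Q) refl d p q P Q)
  (solve 5 (λ d p q P Q → q :* (d :* Q :+ P) := d :* q :* Q :+ P :* q) refl d p q P Q) h)
  where open ℕ-Solver.+-*-Solver

cons-antitone-≤ᶠ : ∀ d ((p , q) (P , Q) : ℕ × ℕ) →
                   (P , Q) ≤ᶠ (p , q) → cons d (p , q) ≤ᶠ cons d (P , Q)
cons-antitone-≤ᶠ d (p , q) (P , Q) h = subst₂ _≤_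
  (solve 5 (λ d p q P Q → d :* q :* Q :+ P :* q := q :* (d :* Q :+ P)) refl d p q P Q)
  (solve 5 (λ d p q P Q → d :* q :* Q :+ p :* Q := Q :* (d :* q :+ p)) refl d p q P Q)
  (+-monoʳ-≤ (d * q * Q) h)
  where open ℕ-Solver.+-*-Solver

cons-between : ∀ a d (x u v : ℕ × ℕ) → Proper x → Proper u → Proper v →
  Between _<ᶠ_ (cons d u) (cons a x) (cons d v) → a ≡ d × Between _<ᶠ_ u x v
cons-between a d x u v x≤ u≤ v≤ (inj₁ (u<x , x<v))
  with refl ← ≤-antisym (cons-<ᶠ⇒≤ a d x u u≤ u<x) (cons-<ᶠ⇒≤ d a v x x≤ x<v)
  = refl , inj₂ (cons-cancel-<ᶠ a v x x<v , cons-cancel-<ᶠ a x u u<x)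
cons-between a d x u v x≤ u≤ v≤ (inj₂ (v<x , x<u))
  with refl ← ≤-antisym (cons-<ᶠ⇒≤ a d x v v≤ v<x) (cons-<ᶠ⇒≤ d a u x x≤ x<u)
  = refl , inj₁ (cons-cancel-<ᶠ a u x x<u , cons-cancel-<ᶠ a x v v<x)

cons-suc : ∀ c → cons (suc c) (0 , 1) ≡ cons c (1 , 1)
cons-suc c =
  cong (1 ,_) (solve 1 (λ c → (con 1 :+ c) :* con 1 :+ con 0 := c :* con 1 :+ con 1) refl c)
  where open ℕ-Solver.+-*-Solver

cons-between-suc : ∀ a c (x : ℕ × ℕ) → Proper x →
  Between _<ᶠ_ (cons c (0 , 1)) (cons a x) (cons (suc c) (0 , 1)) → a ≡ c
cons-between-suc a c x x≤ (inj₁ (c<x , x<c+1)) =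
  ≤-antisym (cons-<ᶠ⇒≤ a c x (0 , 1) z≤n c<x) (<⇒≤ (cons-<ᶠ⇒≤ (suc c) a (0 , 1) x x≤ x<c+1))
cons-between-suc a c x x≤ (inj₂ (c+1<x , x<c)) =
  ≤-antisym (cons-<ᶠ⇒≤ a c x (1 , 1) ≤-refl (subst (_<ᶠ cons a x) (cons-suc c) c+1<x))
            (cons-<ᶠ⇒≤ c a (0 , 1) x x≤ x<c)

AllPositive : List ℕ → Set
AllPositive = List.All (0 <_)

m≤n*m+o : ∀ {n} m o → 0 < n → m ≤ n * m + o
m≤n*m+o {n} m o 0<n = ≤-trans (m≤n*m m n {{>-nonZero 0<n}}) (m≤m+n (n * m) o)

cfPair-proper : ∀ {l} → AllPositive l → Proper (cfPair l)
cfPair-proper List.[]        = z≤n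
cfPair-proper (0<a List.∷ _) = m≤n*m+o _ _ 0<a

cfPair-denominator>0 : ∀ {l} → AllPositive l → 0 < proj₂ (cfPair l)
cfPair-denominator>0 List.[]          = z<s
cfPair-denominator>0 (0<a List.∷ l⁺) = ≤-trans (cfPair-denominator>0 l⁺) (m≤n*m+o _ _ 0<a)

cf-mono-≤ : ∀ {l l′} → AllPositive l → AllPositive l′ → cfPair l ≤ᶠ cfPair l′ → cf l ℚ.≤ cf l′
cf-mono-≤ l⁺ l′⁺ = frac-mono-≤ _ _ (cfPair-denominator>0 l⁺) (cfPair-denominator>0 l′⁺)

cf-cancel-< : ∀ {l l′} → AllPositive l → AllPositive l′ → cf l ℚ.< cf l′ → cfPair l <ᶠ cfPair l′
cf-cancel-< l⁺ l′⁺ = frac-cancel-< _ _ (cfPair-denominator>0 l⁺) (cfPair-denominator>0 l′⁺)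

cf-Between⁻¹ : ∀ {l l′ l″} → AllPositive l → AllPositive l′ → AllPositive l″ →
  Between ℚ._<_ (cf l) (cf l′) (cf l″) → Between _<ᶠ_ (cfPair l) (cfPair l′) (cfPair l″)
cf-Between⁻¹ l⁺ l′⁺ l″⁺ (inj₁ (h , h′)) = inj₁ (cf-cancel-< l⁺ l′⁺ h , cf-cancel-< l′⁺ l″⁺ h′)
cf-Between⁻¹ l⁺ l′⁺ l″⁺ (inj₂ (h , h′)) = inj₂ (cf-cancel-< l″⁺ l′⁺ h , cf-cancel-< l′⁺ l⁺ h′)

cfPair-cylinder : ∀ {pre c m} (a : ℕ → ℕ) → AllPositive pre → 0 < c → (∀ i → 0 < a i) →
  length pre < m →
  Between _<ᶠ_ (cfPair (pre ∷ʳ c)) (cfPair (prefix a m)) (cfPair (pre ∷ʳ suc c)) →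
  prefix a (suc (length pre)) ≡ pre ∷ʳ c
cfPair-cylinder {m = zero} _ _ _ _ () _
cfPair-cylinder {[]} {c} {suc m} a _ _ a⁺ _ btw =
  cong (List._∷ []) (cons-between-suc (a 0) c (cfPair (prefix (a ∘ suc) m))
                       (cfPair-proper (applyUpTo⁺₂ (a ∘ suc) m (a⁺ ∘ suc))) btw)
cfPair-cylinder {d ∷ pre} {c} {suc m} a (_ List.∷ pre⁺) 0<c a⁺ (s≤s ∣pre∣<m) btw =
  let a₀≡d , btw′ = cons-between (a 0) d
                      (cfPair (prefix (a ∘ suc) m)) (cfPair (pre ∷ʳ c)) (cfPair (pre ∷ʳ suc c))
                      (cfPair-proper (applyUpTo⁺₂ (a ∘ suc) m (a⁺ ∘ suc)))
                      (cfPair-proper (∷ʳ⁺ pre⁺ 0<c)) (cfPair-proper (∷ʳ⁺ pre⁺ z<s)) btw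
  in cong₂ _∷_ a₀≡d (cfPair-cylinder (a ∘ suc) pre⁺ 0<c (a⁺ ∘ suc) ∣pre∣<m btw′)

prefix-suc⁻¹ : ∀ (a : ℕ → ℕ) n {l x} → prefix a (suc n) ≡ l ∷ʳ x → prefix a n ≡ l × a n ≡ x
prefix-suc⁻¹ a n {l} eq = ∷ʳ-injective (prefix a n) l (trans (applyUpTo-∷ʳ a n) eq)

data EvenLength {A : Set} : List A → Set where
  []     : EvenLength []
  extend : ∀ {x y l} → EvenLength l → EvenLength (x ∷ y ∷ l)

even-length : ∀ q (l : List ℕ) → length l ≡ q * 2 → EvenLength l
even-length zero    []          _  = []
even-length (suc q) (x ∷ y ∷ l) eq = extend (even-length q l (suc-injective (suc-injective eq)))

cfPair-snoc-antitone : ∀ {L s t} → EvenLength L → s ≤ t → cfPair (L ∷ʳ t) ≤ᶠ cfPair (L ∷ʳ s)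
cfPair-snoc-antitone []      s≤t = *-monoʳ-≤ 1 (+-monoˡ-≤ 0 (*-monoˡ-≤ 1 s≤t))
cfPair-snoc-antitone {x ∷ y ∷ L} {s} {t} (extend ev) s≤t =
  cons-antitone-≤ᶠ x (cfPair (y ∷ L ∷ʳ t)) (cfPair (y ∷ L ∷ʳ s))
    (cons-antitone-≤ᶠ y (cfPair (L ∷ʳ s)) (cfPair (L ∷ʳ t)) (cfPair-snoc-antitone ev s≤t))

cf-snoc-antitone : ∀ {L s t} → EvenLength L → AllPositive L → 0 < s → s ≤ t →
                   cf (L ∷ʳ t) ℚ.≤ cf (L ∷ʳ s)
cf-snoc-antitone ev L⁺ 0<s s≤t =
  cf-mono-≤ (∷ʳ⁺ L⁺ (≤-trans 0<s s≤t)) (∷ʳ⁺ L⁺ 0<s) (cfPair-snoc-antitone ev s≤t)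

concat-prefix : ∀ b (a a′ : ℕ → ℕ) n → prefix a n ≡ prefix a′ n →
  concatNum b a n ≡ concatNum b a′ n × concatLen b a n ≡ concatLen b a′ n
concat-prefix b a a′ zero    _  = refl , refl
concat-prefix b a a′ (suc n) eq
  with pre≡ , an≡ ← prefix-suc⁻¹ a n (trans eq (sym (applyUpTo-∷ʳ a′ n)))
  with X≡ , ℓ≡ ← concat-prefix b a a′ n pre≡
  = cong₂ (λ X x → X * b ^ numDigits b x + x) X≡ an≡ , cong₂ (λ ℓ x → ℓ + numDigits b x) ℓ≡ an≡

-- Y has the digits of X followed by e more, Y′ those of X′ followed by e′ more.
extension-≤ : ∀ b {X X′ Y Y′} ℓ e e′ → X < X′ → Y < suc X * b ^ e → X′ * b ^ e′ ≤ Y′ →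
              Y * b ^ (ℓ + e′) ≤ Y′ * b ^ (ℓ + e)
extension-≤ b {X} {X′} {Y} {Y′} ℓ e e′ X<X′ Y< Y′≥ = begin
  Y * b ^ (ℓ + e′)                ≤⟨ *-monoˡ-≤ (b ^ (ℓ + e′)) (<⇒≤ Y<) ⟩
  suc X * b ^ e * b ^ (ℓ + e′)    ≡⟨ cong (suc X * b ^ e *_) (^-distribˡ-+-* b ℓ e′) ⟩
  suc X * b ^ e * (b ^ ℓ * b ^ e′) ≡⟨ solve 4 (λ x p q r → x :* p :* (r :* q) := x :* q :* (r :* p))
                                              refl (suc X) (b ^ e) (b ^ e′) (b ^ ℓ) ⟩
  suc X * b ^ e′ * (b ^ ℓ * b ^ e) ≡⟨ cong (suc X * b ^ e′ *_) (^-distribˡ-+-* b ℓ e) ⟨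
  suc X * b ^ e′ * b ^ (ℓ + e)    ≤⟨ *-monoˡ-≤ (b ^ (ℓ + e)) (*-monoˡ-≤ (b ^ e′) X<X′) ⟩
  X′ * b ^ e′ * b ^ (ℓ + e)       ≤⟨ *-monoˡ-≤ (b ^ (ℓ + e)) Y′≥ ⟩
  Y′ * b ^ (ℓ + e)                ∎
  where
  open ≤-Reasoning
  open ℕ-Solver.+-*-Solver

module _ {b : ℕ} (1<b : 1 < b) where

  private instance
    b-nonZero : NonZero b
    b-nonZero = >-nonZero (<-trans z<s 1<b)

  n<b^n : ∀ n → n < b ^ n
  n<b^n zero    = z<s
  n<b^n (suc n) = begin-strict
    suc n      ≤⟨ n<b^n n ⟩
    b ^ n      <⟨ m<m*n (b ^ n) b {{m^n≢0 b n}} 1<b ⟩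
    b ^ n * b  ≡⟨ *-comm (b ^ n) b ⟩
    b * b ^ n  ∎
    where open ≤-Reasoning

  numDigitsAux-bound : ∀ a f L → a < b ^ numDigitsAux b a f L ⊎ numDigitsAux b a f L ≡ L + f
  numDigitsAux-bound a zero    L = inj₂ (sym (+-identityʳ L))
  numDigitsAux-bound a (suc f) L with b ^ L ≤? a
  ... | no b^L≰a = inj₁ (≰⇒> b^L≰a)
  ... | yes _ with numDigitsAux-bound a f (suc L)
  ...   | inj₁ a<   = inj₁ a<
  ...   | inj₂ ≡L+f = inj₂ (trans ≡L+f (sym (+-suc L f)))

  numDigits-bound : ∀ a → a < b ^ numDigits b a
  numDigits-bound a with numDigitsAux-bound a (suc a) 0
  ... | inj₁ a<  = a<
  ... | inj₂ ≡1+a rewrite ≡1+a = <-trans (n<1+n a) (n<b^n (suc a))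

  numDigitsAux-exact : ∀ {k c} → b ^ k ≤ c → c < b ^ suc k →
    ∀ f L → L ≤ suc k → suc k ≤ L + f → numDigitsAux b c f L ≡ suc k
  numDigitsAux-exact {k} lo hi zero L L≤ ≤L = ≤-antisym L≤ (subst (suc k ≤_) (+-identityʳ L) ≤L)
  numDigitsAux-exact {k} {c} lo hi (suc f) L L≤ ≤L with b ^ L ≤? c | L ≤? k
  ... | yes _      | yes L≤k =
    numDigitsAux-exact lo hi f (suc L) (s≤s L≤k) (subst (suc k ≤_) (+-suc L f) ≤L)
  ... | yes b^L≤c  | no L≰k  =
    ⊥-elim (<⇒≱ hi (subst (λ L → b ^ L ≤ c) (≤-antisym L≤ (≰⇒> L≰k)) b^L≤c))
  ... | no b^L≰c   | yes L≤k = ⊥-elim (b^L≰c (≤-trans (^-monoʳ-≤ b L≤k) lo))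
  ... | no _       | no L≰k  = ≤-antisym L≤ (≰⇒> L≰k)

  numDigits-exact : ∀ {k c} → b ^ k ≤ c → c < b ^ suc k → numDigits b c ≡ suc k
  numDigits-exact {k} lo hi = numDigitsAux-exact lo hi _ 0 z≤n (s≤s (<⇒≤ (<-≤-trans (n<b^n k) lo)))

  concat-extends : ∀ (a : ℕ → ℕ) N j → ∃[ e ] (concatLen b a (j + N) ≡ concatLen b a N + e
    × concatNum b a N * b ^ e ≤ concatNum b a (j + N)
    × concatNum b a (j + N) < suc (concatNum b a N) * b ^ e)
  concat-extends a N zero =
    0 , sym (+-identityʳ _) , ≤-reflexive (*-identityʳ _)
      , ≤-reflexive (cong suc (sym (*-identityʳ _)))
  concat-extends a N (suc j) with concat-extends a N j
  ... | e , len , X≤ , <X =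
    e + d , trans (cong (_+ d) len) (+-assoc (concatLen b a N) e d) , X≤′ , <X′
    where
    open ≤-Reasoning
    d = numDigits b (a (j + N))
    Y = concatNum b a (j + N)
    X = concatNum b a N
    X≤′ : X * b ^ (e + d) ≤ Y * b ^ d + a (j + N)
    X≤′ = begin
      X * b ^ (e + d)      ≡⟨ cong (X *_) (^-distribˡ-+-* b e d) ⟩
      X * (b ^ e * b ^ d)  ≡⟨ *-assoc X (b ^ e) (b ^ d) ⟨
      X * b ^ e * b ^ d    ≤⟨ *-monoˡ-≤ (b ^ d) X≤ ⟩
      Y * b ^ d            ≤⟨ m≤m+n _ _ ⟩
      Y * b ^ d + a (j + N) ∎
    <X′ : Y * b ^ d + a (j + N) < suc X * b ^ (e + d)
    <X′ = begin-strict
      Y * b ^ d + a (j + N)      <⟨ +-monoʳ-< (Y * b ^ d) (numDigits-bound (a (j + N))) ⟩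
      Y * b ^ d + b ^ d          ≡⟨ +-comm (Y * b ^ d) _ ⟩
      suc Y * b ^ d              ≤⟨ *-monoˡ-≤ (b ^ d) <X ⟩
      suc X * b ^ e * b ^ d      ≡⟨ *-assoc (suc X) (b ^ e) (b ^ d) ⟩
      suc X * (b ^ e * b ^ d)    ≡⟨ cong (suc X *_) (^-distribˡ-+-* b e d) ⟨
      suc X * b ^ (e + d)        ∎

  digitSeq-≤ : ∀ (a a′ : ℕ → ℕ) n j j′ → prefix a n ≡ prefix a′ n → a n < a′ n →
    numDigits b (a n) ≡ numDigits b (a′ n) →
    digitSeq b a (j + suc n) ℚ.≤ digitSeq b a′ (j′ + suc n)
  digitSeq-≤ a a′ n j j′ eq an<a′n same-digits
    with X≡ , ℓ≡ ← concat-prefix b a a′ n eq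
    with e , len , _ , Y< ← concat-extends a (suc n) j
    with e′ , len′ , Y′≥ , _ ← concat-extends a′ (suc n) j′
    = frac-mono-≤ _ _ (m^n>0 b (concatLen b a (j + suc n))) (m^n>0 b (concatLen b a′ (j′ + suc n)))
        (subst₂ (λ L L′ → concatNum b a (j + suc n) * b ^ L′ ≤ concatNum b a′ (j′ + suc n) * b ^ L)
          (sym len) (sym (trans len′ (cong (_+ e′) (sym same-length))))
          (extension-≤ b (concatLen b a (suc n)) e e′ X<X′ Y< Y′≥))
    where
    same-length : concatLen b a (suc n) ≡ concatLen b a′ (suc n)
    same-length = cong₂ _+_ ℓ≡ same-digits
    X<X′ : concatNum b a (suc n) < concatNum b a′ (suc n)
    X<X′ = begin-strict
      concatNum b a n * b ^ numDigits b (a n) + a n   <⟨ +-monoʳ-< _ an<a′n ⟩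
      concatNum b a n * b ^ numDigits b (a n) + a′ n
        ≡⟨ cong₂ (λ X d → X * b ^ d + a′ n) X≡ same-digits ⟩
      concatNum b a′ n * b ^ numDigits b (a′ n) + a′ n ∎
      where open ≤-Reasoning

  trott-cylinder : ∀ {pre c} → EvenLength pre → AllPositive pre → 0 < c → IntersectsTrott b pre c →
    ∃[ a ] (prefix a (length pre) ≡ pre × a (length pre) ≡ c ×
            ∃[ j ] (cf (pre ∷ʳ suc c) ℚ.< digitSeq b a (j + suc (length pre))
                    × digitSeq b a (j + suc (length pre)) ℚ.< cf (pre ∷ʳ c)))
  trott-cylinder {pre} {c} ev pre⁺ 0<c (a , (a⁺ , _ , cf≈digits) , x∈I)
    with j , cf∈I , digits∈I ←
           eventually-beyond (eventually-between {s = cfSeq a} {t = digitSeq b a} x∈I cf≈digits)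
                             (suc (length pre))
    with prefix≡ , a≡c ← prefix-suc⁻¹ a (length pre)
           (cfPair-cylinder a pre⁺ 0<c a⁺ (m≤n+m _ j)
             (cf-Between⁻¹ (∷ʳ⁺ pre⁺ 0<c) (applyUpTo⁺₂ a (j + suc (length pre)) a⁺)
                           (∷ʳ⁺ pre⁺ z<s) cf∈I))
    = a , prefix≡ , a≡c , j , Between-oriented (cf-snoc-antitone ev pre⁺ 0<c (n≤1+n c)) digits∈I

  not-both-intersect : ∀ {pre k c c′} → EvenLength pre → AllPositive pre →
    b ^ k ≤ c → c < b ^ suc k → b ^ k ≤ c′ → c′ < b ^ suc k → c < c′ →
    IntersectsTrott b pre c → IntersectsTrott b pre c′ → ⊥
  not-both-intersect {pre} {k} {c} {c′} ev pre⁺ lo hi lo′ hi′ c<c′ I∩T I′∩T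
    with 0<c ← <-≤-trans (m^n>0 b k) lo
    with a , prefix≡ , refl , j , I<x , _ ← trott-cylinder ev pre⁺ 0<c I∩T
    with a′ , prefix′≡ , refl , j′ , _ , x′<I′ ← trott-cylinder ev pre⁺ (<-trans 0<c c<c′) I′∩T
    = ℚ.<-irrefl-≡ refl (begin-strict
      digitSeq b a′ (j′ + suc (length pre))  <⟨ x′<I′ ⟩
      cf (pre ∷ʳ c′)                          ≤⟨ cf-snoc-antitone ev pre⁺ z<s c<c′ ⟩
      cf (pre ∷ʳ suc c)                       <⟨ I<x ⟩
      digitSeq b a (j + suc (length pre))     ≤⟨ digitSeq-≤ a a′ (length pre) j j′
                                                   (trans prefix≡ (sym prefix′≡)) c<c′ same-digits ⟩
      digitSeq b a′ (j′ + suc (length pre))  ∎)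
    where
    open ℚ.≤-Reasoning
    same-digits : numDigits b c ≡ numDigits b c′
    same-digits = trans (numDigits-exact {k} lo hi) (sym (numDigits-exact {k} lo′ hi′))

lemma5p1 : (b : ℕ) → 2 ≤ b →
    (n : ℕ) → 2 ∣ n → 2 ≤ n →
    (as : Vec ℕ n) → All (λ x → 1 ≤ x) as →
    (k c c′ : ℕ) →
    b ^ k ≤ c → c < b ^ suc k →
    b ^ k ≤ c′ → c′ < b ^ suc k →
    IntersectsTrott b (toList as) c →
    IntersectsTrott b (toList as) c′ →
    c ≡ c′
lemma5p1 b 1<b n (divides q n≡q*2) _ as as⁺ k c c′ lo hi lo′ hi′ I∩T I′∩T =
  ≤-antisym (≮⇒≥ λ c′<c → not-both-intersect 1<b {k = k} ev as⁺′ lo′ hi′ lo hi c′<c I′∩T I∩T)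
            (≮⇒≥ λ c<c′ → not-both-intersect 1<b {k = k} ev as⁺′ lo hi lo′ hi′ c<c′ I∩T I′∩T)
  where
  as⁺′ : AllPositive (toList as)
  as⁺′ = toList⁺ as⁺
  ev : EvenLength (toList as)
  ev = even-length q (toList as) (trans (length-toList as) n≡q*2)
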